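{- For every circular area sequence $\mathbf a$, the two-variable specialization $\mathrm G_{\mathbf a}(x_1,x_2;q+1)$ (all variables other than $x_1,x_2$ set to $0$) is a linear combination of the products $\mathrm e_1(x_1,x_2)^i\mathrm e_2(x_1,x_2)^j$ whose coefficients are polynomials in $q$ with non-negative coefficients.
   Context: A circular area sequence is an integer sequence $\mathbf a=(a_1,\dots,a_n)$ with $0\le a_i\le n-1$ and $a_i-1\le a_{i+1}$ for all $i$, indices mod $n$. $\Gamma_{\mathbf a}$ is the directed graph on $[n]$ with edges $i\to i+1,\dots,i\to i+a_i$ (labels mod $n$). $\mathrm G_{\mathbf a}(\mathbf x;q)=\sum_F\mathbf x^F q^{\mathrm{asc}_{\mathbf a}(F)}$ over all maps $F:[n]\to\mathbb Z_{>0}$, where $\mathbf x^F=\prod_vx_{F(v)}$ and $\mathrm{asc}_{\mathbf a}(F)$ is the number of edges $i\to j$ of $\Gamma_{\mathbf a}$ with $F(i)<F(j)$. $\mathrm e_1(x_1,x_2)=x_1+x_2$, $\mathrm e_2(x_1,x_2)=x_1x_2$. -}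

module Defs where

open import Data.Nat using (ℕ; zero; suc; _+_; _*_; _∸_; _^_; _≤_; _<ᵇ_; NonZero)
open import Data.Nat.DivMod using (_mod_)
open import Data.Fin using (Fin; toℕ)
import Data.Fin as Fin
open import Data.Bool using (if_then_else_)
open import Data.List using (List; []; _∷_; map; concatMap; upTo; allFin)
open import Data.Nat.ListAction using (sum; product)
open import Data.Product using (_×_; _,_)

-- Vertex labels [n] are represented by Fin n (0-based); index arithmetic is mod n.
-- i +ₙ k  =  (i + k) mod n
_+ₙ_ : ∀ {n} .{{_ : NonZero n}} → Fin n → ℕ → Fin n
_+ₙ_ {n} i k = (toℕ i + k) mod n

record IsCircularAreaSequence (n : ℕ) .{{_ : NonZero n}} (a : Fin n → ℕ) : Set where
  field
    bounded : ∀ i → a i ≤ n ∸ 1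
    circ    : ∀ i → a i ≤ suc (a (i +ₙ 1))   -- i.e. a_i - 1 ≤ a_{i+1}

-- asc_a(F): number of edges i → i+k (1 ≤ k ≤ a_i) of Γ_a with F(i) < F(i+k).
asc : ∀ {n} .{{_ : NonZero n}} → (Fin n → ℕ) → (Fin n → ℕ) → ℕ
asc {n} a F =
  sum (map (λ i → sum (map (λ k → if F i <ᵇ F (i +ₙ suc k) then 1 else 0)
                           (upTo (a i))))
           (allFin n))

consF : ∀ {n} → ℕ → (Fin n → ℕ) → Fin (suc n) → ℕ
consF c f Fin.zero    = c
consF c f (Fin.suc i) = f i

twoColorings : (n : ℕ) → List (Fin n → ℕ)
twoColorings zero    = (λ ()) ∷ []
twoColorings (suc n) = concatMap (λ f → consF 1 f ∷ consF 2 f ∷ []) (twoColorings n)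

xvar : ℕ → ℕ → ℕ → ℕ
xvar x₁ x₂ 1 = x₁
xvar x₁ x₂ 2 = x₂
xvar x₁ x₂ _ = 0

monomial : ∀ {n} → ℕ → ℕ → (Fin n → ℕ) → ℕ
monomial {n} x₁ x₂ F = product (map (λ v → xvar x₁ x₂ (F v)) (allFin n))

-- G_a(x₁, x₂, 0, 0, …; t), evaluated at natural numbers x₁ x₂ t.
-- Maps F using a colour ≥ 3 contribute 0 (some x_c = 0), so only F : [n] → {1,2} remain.
G₂ : ∀ {n} .{{_ : NonZero n}} → (Fin n → ℕ) → ℕ → ℕ → ℕ → ℕ
G₂ {n} a x₁ x₂ t =
  sum (map (λ F → monomial x₁ x₂ F * t ^ asc a F) (twoColorings n))

-- A polynomial in q with non-negative integer coefficients, as coefficient list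
-- [c₀, c₁, …] meaning c₀ + c₁ q + c₂ q² + …
evalPoly : List ℕ → ℕ → ℕ
evalPoly []       q = 0
evalPoly (c ∷ cs) q = c + q * evalPoly cs q

e₁ e₂ : ℕ → ℕ → ℕ
e₁ x₁ x₂ = x₁ + x₂
e₂ x₁ x₂ = x₁ * x₂

linComb : List (ℕ × ℕ × List ℕ) → ℕ → ℕ → ℕ → ℕ
linComb []                 x₁ x₂ q = 0
linComb ((i , j , c) ∷ ts) x₁ x₂ q =
  evalPoly c q * e₁ x₁ x₂ ^ i * e₂ x₁ x₂ ^ j + linComb ts x₁ x₂ q

{-# OPTIONS --safe #-}

-- Let some vertices of a digraph be free and the others frozen to a color, and let G count
-- ascents only between free vertices. For an edge i → j between free vertices,
-- (1 + q) ^ [F i < F j] = 1 + q [F i = 1] [F j = 2], so G is G without that edge plus q x₁ x₂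
-- times G with i and j frozen to the colors 1 and 2. If moreover the other free vertices reached
-- from i are exactly those reaching j, each of them is an ascent from i or into j, whatever its
-- color, and the second term becomes q e₂ (1 + q) ^ k G′ with k the number of such vertices.
-- In Γ_a, and in every digraph this recursion produces from it, the edges span arcs whose free
-- inner vertices are joined to both ends, so a longest edge has that property. The recursion
-- stops at edgeless digraphs, whose G is a power of e₁.

module Submission where

open import Defs
import Algebra.Properties.CommutativeSemigroup as CommutativeSemigroupProperties
import Algebra.Properties.Monoid.Sum as MonoidSum
import Algebra.Properties.Semiring.Sum as SemiringSum
open import Data.Bool using (Bool; true; false; if_then_else_; _∧_; not)
import Data.Bool.Properties as Bool
open import Data.Bool.Properties using (∧-zeroʳ; ∧-identityʳ)
open import Data.Empty using (⊥-elim)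
open import Data.Fin using (Fin; toℕ; _≟_) renaming (zero to fzero; suc to fsuc)
open import Data.Fin.Properties using (toℕ-injective; toℕ<n; toℕ-fromℕ<)
open import Data.List
  using (List; []; _∷_; _++_; _∷ʳ_; map; concatMap; allFin; tabulate; upTo; filter; cartesianProduct)
open import Data.List.Extrema.Nat using (argmax; argmax-all; f[⊥]≤f[argmax]; f[xs]≤f[argmax])
open import Data.List.Membership.Propositional using (_∈_)
open import Data.List.Membership.Propositional.Properties using (∈-filter⁺; ∈-cartesianProduct⁺; ∈-allFin)
open import Data.List.Properties using (map-++; map-cong; map-tabulate; upTo-∷ʳ)
open import Data.List.Relation.Unary.All as All using (All; _∷_)
open import Data.List.Relation.Unary.All.Properties using (all-filter)
open import Data.List.Relation.Unary.Any using (here; there)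
open import Data.Nat
  using ( ℕ; zero; suc; _+_; _*_; _∸_; _^_; _%_; _≤_; _<_; z≤n; s≤s; _<?_; _<ᵇ_; _≤ᵇ_; _≡ᵇ_
        ; NonZero; >-nonZero⁻¹)
open import Data.Nat.DivMod using (%-distribˡ-+; m%n%n≡m%n; m%n<n; m<n⇒m%n≡m; [m+n]%n≡m%n)
open import Data.Nat.ListAction using (sum; product)
open import Data.Nat.ListAction.Properties using (sum-++)
open import Data.Nat.Properties hiding (_≟_)
open import Data.Nat.Solver using (module +-*-Solver)
open import Data.Product using (Σ; _×_; _,_; proj₁; proj₂; uncurry)
open import Data.Sum using (_⊎_; inj₁; inj₂)
open import Data.Vec.Functional using (updateAt)
open import Data.Vec.Functional.Properties using (updateAt-updates; updateAt-minimal)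
open import Function using (_∘_; id; mk⇔; module Equivalence)
open import Relation.Binary.Definitions using (tri<; tri≈; tri>)
open import Relation.Binary.PropositionalEquality
open import Relation.Nullary using (Dec; does; yes; no)
open import Relation.Nullary.Decidable using (dec-true; dec-false)
open import Relation.Unary using (Decidable)

open CommutativeSemigroupProperties +-commutativeSemigroup using () renaming (interchange to +-interchange)
open MonoidSum *-1-monoid using () renaming (sum to ∏)
open SemiringSum +-*-semiring
  using (sum-syntax; sum-cong-≗; ∑-distrib-+; *-distribˡ-sum; sum-replicate-zero) renaming (sum to ∑)
open +-*-Solver using (solve; _:=_; _:+_; _:*_; con)
open Equivalence using (to; from)
open ≡-Reasoning

⟦_⟧ : Bool → ℕ
⟦ b ⟧ = if b then 1 else 0

⟦∧⟧ : ∀ x y → ⟦ x ∧ y ⟧ ≡ ⟦ x ⟧ * ⟦ y ⟧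
⟦∧⟧ true  y = sym (+-identityʳ ⟦ y ⟧)
⟦∧⟧ false y = refl

⟦<ᵇ-suc⟧ : ∀ d A → ⟦ d <ᵇ suc A ⟧ ≡ ⟦ d <ᵇ A ⟧ + ⟦ d ≡ᵇ A ⟧
⟦<ᵇ-suc⟧ zero    zero    = refl
⟦<ᵇ-suc⟧ zero    (suc A) = refl
⟦<ᵇ-suc⟧ (suc d) zero    = refl
⟦<ᵇ-suc⟧ (suc d) (suc A) = ⟦<ᵇ-suc⟧ d A

n<ᵇn≡false : ∀ m → (m <ᵇ m) ≡ false
n<ᵇn≡false zero    = refl
n<ᵇn≡false (suc m) = n<ᵇn≡false m

∧-∧-false : ∀ x y → (x ∧ y ∧ false) ≡ false
∧-∧-false x y rewrite ∧-zeroʳ y = ∧-zeroʳ x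

split-by-color : ∀ e {c} → c ≡ 1 ⊎ c ≡ 2 → ⟦ e ∧ (1 <ᵇ c) ⟧ + ⟦ e ∧ (c <ᵇ 2) ⟧ ≡ ⟦ e ⟧
split-by-color true  (inj₁ refl) = refl
split-by-color true  (inj₂ refl) = refl
split-by-color false (inj₁ refl) = refl
split-by-color false (inj₂ refl) = refl

color≮1 : ∀ {c} → c ≡ 1 ⊎ c ≡ 2 → (c <ᵇ 1) ≡ false
color≮1 (inj₁ refl) = refl
color≮1 (inj₂ refl) = refl

color≯2 : ∀ {c} → c ≡ 1 ⊎ c ≡ 2 → (2 <ᵇ c) ≡ false
color≯2 (inj₁ refl) = refl
color≯2 (inj₂ refl) = refl

δ : ∀ {n} → Fin n → Fin n → ℕ
δ u v = ⟦ does (u ≟ v) ⟧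

∑-δ : ∀ {n} (v : Fin n) (g : Fin n → ℕ) → ∑[ u < n ] (δ u v * g u) ≡ g v
∑-δ {suc n} fzero g = begin
  g fzero + 0 + ∑ {n} (λ _ → 0) ≡⟨ cong₂ _+_ (+-identityʳ (g fzero)) (sum-replicate-zero n) ⟩
  g fzero + 0                   ≡⟨ +-identityʳ (g fzero) ⟩
  g fzero                       ∎
∑-δ {suc n} (fsuc v) g = ∑-δ v (g ∘ fsuc)

∑-zero : ∀ {n} {f : Fin n → ℕ} → (∀ u → f u ≡ 0) → ∑ f ≡ 0
∑-zero {n} f≡0 = trans (sum-cong-≗ f≡0) (sum-replicate-zero n)

∑-mono : ∀ {n} {f g : Fin n → ℕ} → (∀ u → f u ≤ g u) → ∑ f ≤ ∑ g
∑-mono {zero}  f≤g = z≤n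
∑-mono {suc n} f≤g = +-mono-≤ (f≤g fzero) (∑-mono (f≤g ∘ fsuc))

∑∑-+ : ∀ {n} (f g : Fin n → Fin n → ℕ) →
  ∑[ a < n ] ∑[ b < n ] (f a b + g a b) ≡ ∑[ a < n ] ∑[ b < n ] f a b + ∑[ a < n ] ∑[ b < n ] g a b
∑∑-+ {n} f g =
  trans (sum-cong-≗ (λ a → ∑-distrib-+ (f a) (g a))) (∑-distrib-+ (λ a → ∑[ b < n ] f a b) _)

∑δ-row : ∀ {n} (v : Fin n) (f : Fin n → ℕ) → ∑[ a < n ] ∑[ b < n ] (δ a v * f b) ≡ ∑[ b < n ] f b
∑δ-row {n} v f = trans (sum-cong-≗ (λ a → sym (*-distribˡ-sum (δ a v) f))) (∑-δ v (λ _ → ∑ f))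

∑δ-col : ∀ {n} (v : Fin n) (f : Fin n → ℕ) → ∑[ a < n ] ∑[ b < n ] (δ b v * f a) ≡ ∑[ a < n ] f a
∑δ-col {n} v f = sum-cong-≗ (λ a → ∑-δ v (λ _ → f a))

∏-zero : ∀ {n} (g : Fin n → ℕ) v → g v ≡ 0 → ∏ g ≡ 0
∏-zero g fzero    gv≡0 rewrite gv≡0 = refl
∏-zero g (fsuc v) gv≡0 rewrite ∏-zero (g ∘ fsuc) v gv≡0 = *-zeroʳ (g fzero)

sum-allFin : ∀ {n} (f : Fin n → ℕ) → sum (map f (allFin n)) ≡ ∑ f
sum-allFin {n} f = trans (cong sum (map-tabulate id f)) (go f)
  where
  go : ∀ {m} (g : Fin m → ℕ) → sum (tabulate g) ≡ ∑ g
  go {zero}  g = refl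
  go {suc m} g = cong (g fzero +_) (go (g ∘ fsuc))

product-allFin : ∀ {n} (f : Fin n → ℕ) → product (map f (allFin n)) ≡ ∏ f
product-allFin {n} f = trans (cong product (map-tabulate id f)) (go f)
  where
  go : ∀ {m} (g : Fin m → ℕ) → product (tabulate g) ≡ ∏ g
  go {zero}  g = refl
  go {suc m} g = cong (g fzero *_) (go (g ∘ fsuc))

sum-map-+ : ∀ {A : Set} (f g : A → ℕ) (xs : List A) →
  sum (map (λ x → f x + g x) xs) ≡ sum (map f xs) + sum (map g xs)
sum-map-+ f g []       = refl
sum-map-+ f g (x ∷ xs) =
  trans (cong (f x + g x +_) (sum-map-+ f g xs)) (+-interchange (f x) (g x) _ _)

sum-map-* : ∀ {A : Set} (c : ℕ) (f : A → ℕ) (xs : List A) →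
  sum (map (λ x → c * f x) xs) ≡ c * sum (map f xs)
sum-map-* c f []       = sym (*-zeroʳ c)
sum-map-* c f (x ∷ xs) = trans (cong (c * f x +_) (sum-map-* c f xs)) (sym (*-distribˡ-+ c (f x) _))

sum-map-concatMap : ∀ {A B : Set} (h : B → ℕ) (g : A → List B) (xs : List A) →
  sum (map h (concatMap g xs)) ≡ sum (map (λ x → sum (map h (g x))) xs)
sum-map-concatMap h g []       = refl
sum-map-concatMap h g (x ∷ xs) = begin
  sum (map h (g x ++ concatMap g xs))                        ≡⟨ cong sum (map-++ h (g x) _) ⟩
  sum (map h (g x) ++ map h (concatMap g xs))                ≡⟨ sum-++ (map h (g x)) _ ⟩
  sum (map h (g x)) + sum (map h (concatMap g xs))           ≡⟨ cong (_ +_) (sum-map-concatMap h g xs) ⟩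
  sum (map h (g x)) + sum (map (λ y → sum (map h (g y))) xs) ∎

-- E-positive functions

Monomial : Set
Monomial = ℕ × ℕ × ℕ

evalMonomial : Monomial → ℕ → ℕ → ℕ → ℕ
evalMonomial (i , j , m) x₁ x₂ q = q ^ m * e₁ x₁ x₂ ^ i * e₂ x₁ x₂ ^ j

evalMonomials : List Monomial → ℕ → ℕ → ℕ → ℕ
evalMonomials μs x₁ x₂ q = sum (map (λ μ → evalMonomial μ x₁ x₂ q) μs)

EPositive : (ℕ → ℕ → ℕ → ℕ) → Set
EPositive f = Σ (List Monomial) λ μs → ∀ x₁ x₂ q → f x₁ x₂ q ≡ evalMonomials μs x₁ x₂ q

EPositive-resp : ∀ {f g : ℕ → ℕ → ℕ → ℕ} → (∀ x₁ x₂ q → f x₁ x₂ q ≡ g x₁ x₂ q) →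
  EPositive g → EPositive f
EPositive-resp f≡g (μs , g≡μs) = μs , λ x₁ x₂ q → trans (f≡g x₁ x₂ q) (g≡μs x₁ x₂ q)

EPositive-const : ∀ c → EPositive (λ _ _ _ → c)
EPositive-const zero    = [] , λ _ _ _ → refl
EPositive-const (suc c) with EPositive-const c
... | μs , c≡μs = (0 , 0 , 0) ∷ μs , λ x₁ x₂ q → cong suc (c≡μs x₁ x₂ q)

evalMonomials-++ : ∀ μs νs x₁ x₂ q →
  evalMonomials (μs ++ νs) x₁ x₂ q ≡ evalMonomials μs x₁ x₂ q + evalMonomials νs x₁ x₂ q
evalMonomials-++ μs νs x₁ x₂ q =
  trans (cong sum (map-++ (λ μ → evalMonomial μ x₁ x₂ q) μs νs)) (sum-++ (map _ μs) _)

EPositive-+ : ∀ {f g : ℕ → ℕ → ℕ → ℕ} → EPositive f → EPositive g →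
  EPositive (λ x₁ x₂ q → f x₁ x₂ q + g x₁ x₂ q)
EPositive-+ (μs , f≡μs) (νs , g≡νs) = μs ++ νs , λ x₁ x₂ q →
  trans (cong₂ _+_ (f≡μs x₁ x₂ q) (g≡νs x₁ x₂ q)) (sym (evalMonomials-++ μs νs x₁ x₂ q))

_·_ : Monomial → Monomial → Monomial
(i , j , m) · (i′ , j′ , m′) = i + i′ , j + j′ , m + m′

evalMonomial-· : ∀ μ ν x₁ x₂ q →
  evalMonomial (μ · ν) x₁ x₂ q ≡ evalMonomial μ x₁ x₂ q * evalMonomial ν x₁ x₂ q
evalMonomial-· (i , j , m) (i′ , j′ , m′) x₁ x₂ q
  rewrite ^-distribˡ-+-* q m m′ | ^-distribˡ-+-* (e₁ x₁ x₂) i i′ | ^-distribˡ-+-* (e₂ x₁ x₂) j j′ =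
  solve 6 (λ Q Q′ A A′ B B′ → Q :* Q′ :* (A :* A′) :* (B :* B′) := Q :* A :* B :* (Q′ :* A′ :* B′))
    refl
    (q ^ m) (q ^ m′) (e₁ x₁ x₂ ^ i) (e₁ x₁ x₂ ^ i′) (e₂ x₁ x₂ ^ j) (e₂ x₁ x₂ ^ j′)

evalMonomials-map-· : ∀ μ νs x₁ x₂ q →
  evalMonomials (map (μ ·_) νs) x₁ x₂ q ≡ evalMonomial μ x₁ x₂ q * evalMonomials νs x₁ x₂ q
evalMonomials-map-· μ []       x₁ x₂ q = sym (*-zeroʳ (evalMonomial μ x₁ x₂ q))
evalMonomials-map-· μ (ν ∷ νs) x₁ x₂ q =
  trans (cong₂ _+_ (evalMonomial-· μ ν x₁ x₂ q) (evalMonomials-map-· μ νs x₁ x₂ q))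
        (sym (*-distribˡ-+ (evalMonomial μ x₁ x₂ q) _ _))

_⊗_ : List Monomial → List Monomial → List Monomial
μs ⊗ νs = concatMap (λ μ → map (μ ·_) νs) μs

evalMonomials-⊗ : ∀ μs νs x₁ x₂ q →
  evalMonomials (μs ⊗ νs) x₁ x₂ q ≡ evalMonomials μs x₁ x₂ q * evalMonomials νs x₁ x₂ q
evalMonomials-⊗ []       νs x₁ x₂ q = refl
evalMonomials-⊗ (μ ∷ μs) νs x₁ x₂ q = begin
  evalMonomials (map (μ ·_) νs ++ μs ⊗ νs) x₁ x₂ q
    ≡⟨ evalMonomials-++ (map (μ ·_) νs) (μs ⊗ νs) x₁ x₂ q ⟩
  evalMonomials (map (μ ·_) νs) x₁ x₂ q + evalMonomials (μs ⊗ νs) x₁ x₂ q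
    ≡⟨ cong₂ _+_ (evalMonomials-map-· μ νs x₁ x₂ q) (evalMonomials-⊗ μs νs x₁ x₂ q) ⟩
  evalMonomial μ x₁ x₂ q * evalMonomials νs x₁ x₂ q +
  evalMonomials μs x₁ x₂ q * evalMonomials νs x₁ x₂ q
    ≡⟨ *-distribʳ-+ (evalMonomials νs x₁ x₂ q) (evalMonomial μ x₁ x₂ q) _ ⟨
  evalMonomials (μ ∷ μs) x₁ x₂ q * evalMonomials νs x₁ x₂ q ∎

EPositive-* : ∀ {f g : ℕ → ℕ → ℕ → ℕ} → EPositive f → EPositive g →
  EPositive (λ x₁ x₂ q → f x₁ x₂ q * g x₁ x₂ q)
EPositive-* (μs , f≡μs) (νs , g≡νs) = μs ⊗ νs , λ x₁ x₂ q →
  trans (cong₂ _*_ (f≡μs x₁ x₂ q) (g≡νs x₁ x₂ q)) (sym (evalMonomials-⊗ μs νs x₁ x₂ q))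

EPositive-^ : ∀ {f : ℕ → ℕ → ℕ → ℕ} k → EPositive f → EPositive (λ x₁ x₂ q → f x₁ x₂ q ^ k)
EPositive-^ zero    pf = EPositive-const 1
EPositive-^ (suc k) pf = EPositive-* pf (EPositive-^ k pf)

EPositive-∏ : ∀ {n} (f : Fin n → ℕ → ℕ → ℕ → ℕ) → (∀ v → EPositive (f v)) →
  EPositive (λ x₁ x₂ q → ∏ (λ v → f v x₁ x₂ q))
EPositive-∏ {zero}  f pf = EPositive-const 1
EPositive-∏ {suc n} f pf = EPositive-* (pf fzero) (EPositive-∏ (f ∘ fsuc) (pf ∘ fsuc))

EPositive-e₁ : EPositive (λ x₁ x₂ _ → e₁ x₁ x₂)
EPositive-e₁ = (1 , 0 , 0) ∷ [] , λ x₁ x₂ _ →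
  solve 1 (λ A → A := con 1 :* (A :* con 1) :* con 1 :+ con 0) refl (e₁ x₁ x₂)

EPositive-e₂ : EPositive (λ x₁ x₂ _ → e₂ x₁ x₂)
EPositive-e₂ = (0 , 1 , 0) ∷ [] , λ x₁ x₂ _ →
  solve 1 (λ B → B := con 1 :* con 1 :* (B :* con 1) :+ con 0) refl (e₂ x₁ x₂)

EPositive-q : EPositive (λ _ _ q → q)
EPositive-q = (0 , 0 , 1) ∷ [] , λ _ _ q →
  solve 1 (λ Q → Q := Q :* con 1 :* con 1 :* con 1 :+ con 0) refl q

qPower : ℕ → List ℕ
qPower zero    = 1 ∷ []
qPower (suc m) = 0 ∷ qPower m

evalPoly-qPower : ∀ m q → evalPoly (qPower m) q ≡ q ^ m
evalPoly-qPower zero    q = cong suc (*-zeroʳ q)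
evalPoly-qPower (suc m) q = cong (q *_) (evalPoly-qPower m q)

toTerms : List Monomial → List (ℕ × ℕ × List ℕ)
toTerms = map λ { (i , j , m) → i , j , qPower m }

linComb-toTerms : ∀ μs x₁ x₂ q → linComb (toTerms μs) x₁ x₂ q ≡ evalMonomials μs x₁ x₂ q
linComb-toTerms []                x₁ x₂ q = refl
linComb-toTerms ((i , j , m) ∷ μs) x₁ x₂ q =
  cong₂ (λ c r → c * e₁ x₁ x₂ ^ i * e₂ x₁ x₂ ^ j + r)
    (evalPoly-qPower m q) (linComb-toTerms μs x₁ x₂ q)

EPositive⇒linComb : ∀ {f : ℕ → ℕ → ℕ → ℕ} → EPositive f →
  Σ (List (ℕ × ℕ × List ℕ)) λ terms → ∀ x₁ x₂ q → f x₁ x₂ q ≡ linComb terms x₁ x₂ q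
EPositive⇒linComb (μs , f≡μs) =
  toTerms μs , λ x₁ x₂ q → trans (f≡μs x₁ x₂ q) (sym (linComb-toTerms μs x₁ x₂ q))

IsTwoColoring : ∀ {n} → (Fin n → ℕ) → Set
IsTwoColoring F = ∀ v → F v ≡ 1 ⊎ F v ≡ 2

Σ₂ : ∀ n → ((Fin n → ℕ) → ℕ) → ℕ
Σ₂ n h = sum (map h (twoColorings n))

Σ₂-suc : ∀ n (h : (Fin (suc n) → ℕ) → ℕ) →
  Σ₂ (suc n) h ≡ Σ₂ n (λ f → h (consF 1 f) + h (consF 2 f))
Σ₂-suc n h = trans (sum-map-concatMap h (λ f → consF 1 f ∷ consF 2 f ∷ []) (twoColorings n))
  (cong sum (map-cong (λ f → cong (h (consF 1 f) +_) (+-identityʳ _)) (twoColorings n)))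

Σ₂-cong : ∀ n {h g : (Fin n → ℕ) → ℕ} → (∀ F → IsTwoColoring F → h F ≡ g F) →
  Σ₂ n h ≡ Σ₂ n g
Σ₂-cong zero    h≡g = cong (_+ 0) (h≡g _ λ ())
Σ₂-cong (suc n) {h} {g} h≡g = begin
  Σ₂ (suc n) h
    ≡⟨ Σ₂-suc n h ⟩
  Σ₂ n (λ f → h (consF 1 f) + h (consF 2 f))
    ≡⟨ Σ₂-cong n (λ f f₂ → cong₂ _+_ (h≡g _ (cons f₂ (inj₁ refl))) (h≡g _ (cons f₂ (inj₂ refl)))) ⟩
  Σ₂ n (λ f → g (consF 1 f) + g (consF 2 f))
    ≡⟨ Σ₂-suc n g ⟨
  Σ₂ (suc n) g ∎
  where
  cons : ∀ {f : Fin n → ℕ} {c} → IsTwoColoring f → c ≡ 1 ⊎ c ≡ 2 → IsTwoColoring (consF c f)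
  cons f₂ c₂ fzero    = c₂
  cons f₂ c₂ (fsuc v) = f₂ v

Σ₂-+ : ∀ n (h g : (Fin n → ℕ) → ℕ) → Σ₂ n (λ F → h F + g F) ≡ Σ₂ n h + Σ₂ n g
Σ₂-+ n h g = sum-map-+ h g (twoColorings n)

Σ₂-* : ∀ n c (h : (Fin n → ℕ) → ℕ) → Σ₂ n (λ F → c * h F) ≡ c * Σ₂ n h
Σ₂-* n c h = sum-map-* c h (twoColorings n)

Σ₂-∏ : ∀ n (g : Fin n → ℕ → ℕ) →
  Σ₂ n (λ F → ∏ (λ v → g v (F v))) ≡ ∏ (λ v → g v 1 + g v 2)
Σ₂-∏ zero    g = refl
Σ₂-∏ (suc n) g = begin
  Σ₂ (suc n) (λ F → ∏ (λ v → g v (F v)))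
    ≡⟨ Σ₂-suc n _ ⟩
  Σ₂ n (λ f → g₀ 1 * P f + g₀ 2 * P f)
    ≡⟨ cong sum (map-cong (λ f → *-distribʳ-+ (P f) (g₀ 1) _) (twoColorings n)) ⟨
  Σ₂ n (λ f → (g₀ 1 + g₀ 2) * P f)
    ≡⟨ Σ₂-* n (g₀ 1 + g₀ 2) P ⟩
  (g₀ 1 + g₀ 2) * Σ₂ n P
    ≡⟨ cong ((g₀ 1 + g₀ 2) *_) (Σ₂-∏ n (g ∘ fsuc)) ⟩
  (g₀ 1 + g₀ 2) * ∏ (λ v → g (fsuc v) 1 + g (fsuc v) 2) ∎
  where
  g₀ : ℕ → ℕ
  g₀ = g fzero
  P : (Fin n → ℕ) → ℕ
  P f = ∏ (λ v → g (fsuc v) (f v))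

-- Digraphs with frozen vertices

-- A frozen vertex carries no variable and no ascents; its weight only selects its color.
data Vertex : Set where
  free  : Vertex
  frozen : ℕ → Vertex

isFree : Vertex → Bool
isFree free      = true
isFree (frozen _) = false

vertexWeight : ℕ → ℕ → Vertex → ℕ → ℕ
vertexWeight x₁ x₂ free      c = xvar x₁ x₂ c
vertexWeight x₁ x₂ (frozen d) c = ⟦ c ≡ᵇ d ⟧

weight : ∀ {n} → (Fin n → Vertex) → ℕ → ℕ → (Fin n → ℕ) → ℕ
weight s x₁ x₂ F = ∏ (λ v → vertexWeight x₁ x₂ (s v) (F v))

freeze : ∀ {n} → (Fin n → Vertex) → Fin n → ℕ → Fin n → Vertex
freeze s v c = updateAt s v (λ _ → frozen c)

freeze-same : ∀ {n} (s : Fin n → Vertex) v c → freeze s v c v ≡ frozen c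
freeze-same s v c = updateAt-updates v s

freeze-other : ∀ {n} (s : Fin n → Vertex) {u v} c → u ≢ v → freeze s v c u ≡ s u
freeze-other s {u} {v} c u≢v = updateAt-minimal u v s u≢v

freeze-free⁻ : ∀ {n} (s : Fin n → Vertex) {u v} c → freeze s v c u ≡ free → s u ≡ free
freeze-free⁻ s {u} {v} c eq with u ≟ v
... | yes refl with () ← trans (sym (freeze-same s u c)) eq
... | no u≢v = trans (sym (freeze-other s c u≢v)) eq

Digraph : ℕ → Set
Digraph n = Fin n → Fin n → Bool

count : ∀ {n} → Digraph n → ℕ
count {n} R = ∑[ a < n ] ∑[ b < n ] ⟦ R a b ⟧

edges : ∀ {n} → (Fin n → Vertex) → Digraph n → ℕ
edges s E = count (λ a b → isFree (s a) ∧ isFree (s b) ∧ E a b)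

ascents : ∀ {n} → (Fin n → Vertex) → Digraph n → (Fin n → ℕ) → ℕ
ascents s E F = count (λ a b → isFree (s a) ∧ isFree (s b) ∧ E a b ∧ (F a <ᵇ F b))

G : ∀ {n} → (Fin n → Vertex) → Digraph n → ℕ → ℕ → ℕ → ℕ
G {n} s E x₁ x₂ t = Σ₂ n (λ F → weight s x₁ x₂ F * t ^ ascents s E F)

removeEdge : ∀ {n} → Digraph n → Fin n → Fin n → Digraph n
removeEdge E i j a b = E a b ∧ not (does (a ≟ i) ∧ does (b ≟ j))

removeEdge-removes : ∀ {n} (E : Digraph n) i j → removeEdge E i j i j ≡ false
removeEdge-removes E i j rewrite dec-true (i ≟ i) refl | dec-true (j ≟ j) refl = ∧-zeroʳ (E i j)

removeEdge-keeps : ∀ {n} (E : Digraph n) {i j a b} → a ≢ i ⊎ b ≢ j → removeEdge E i j a b ≡ E a b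
removeEdge-keeps E {i} {j} {a} {b} (inj₁ a≢i) rewrite dec-false (a ≟ i) a≢i = ∧-identityʳ (E a b)
removeEdge-keeps E {i} {j} {a} {b} (inj₂ b≢j)
  rewrite dec-false (b ≟ j) b≢j | ∧-zeroʳ (does (a ≟ i)) = ∧-identityʳ (E a b)

count-remove : ∀ {n} (R R′ : Digraph n) {i j} → R′ i j ≡ false →
  (∀ {a b} → a ≢ i ⊎ b ≢ j → R′ a b ≡ R a b) → count R ≡ count R′ + ⟦ R i j ⟧
count-remove {n} R R′ {i} {j} R′ij≡false R′≡R = begin
  count R
    ≡⟨ sum-cong-≗ (λ a → sum-cong-≗ (split a)) ⟩
  ∑[ a < n ] ∑[ b < n ] (⟦ R′ a b ⟧ + δ a i * (δ b j * ⟦ R i j ⟧))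
    ≡⟨ ∑∑-+ (λ a b → ⟦ R′ a b ⟧) _ ⟩
  count R′ + ∑[ a < n ] ∑[ b < n ] (δ a i * (δ b j * ⟦ R i j ⟧))
    ≡⟨ cong (count R′ +_) (∑δ-row i (λ b → δ b j * ⟦ R i j ⟧)) ⟩
  count R′ + ∑[ b < n ] (δ b j * ⟦ R i j ⟧)
    ≡⟨ cong (count R′ +_) (∑-δ j (λ _ → ⟦ R i j ⟧)) ⟩
  count R′ + ⟦ R i j ⟧ ∎
  where
  split : ∀ a b → ⟦ R a b ⟧ ≡ ⟦ R′ a b ⟧ + δ a i * (δ b j * ⟦ R i j ⟧)
  split a b with a ≟ i | b ≟ j
  ... | yes refl | yes refl rewrite R′ij≡false = sym (trans (+-identityʳ _) (+-identityʳ _))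
  ... | yes refl | no b≢j = trans (cong ⟦_⟧ (sym (R′≡R (inj₂ b≢j)))) (sym (+-identityʳ _))
  ... | no a≢i   | _      = trans (cong ⟦_⟧ (sym (R′≡R (inj₁ a≢i)))) (sym (+-identityʳ _))

outAscents inAscents : ∀ {n} → (Fin n → Vertex) → Digraph n → (Fin n → ℕ) → Fin n → ℕ
outAscents {n} s E F v = ∑[ b < n ] ⟦ isFree (s b) ∧ E v b ∧ (F v <ᵇ F b) ⟧
inAscents  {n} s E F v = ∑[ a < n ] ⟦ isFree (s a) ∧ E a v ∧ (F a <ᵇ F v) ⟧

ascents-freeze : ∀ {n} (s : Fin n → Vertex) (E : Digraph n) (F : Fin n → ℕ) {v} c → s v ≡ free →
  let s′ = freeze s v c in ascents s E F ≡ ascents s′ E F + (outAscents s′ E F v + inAscents s′ E F v)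
ascents-freeze {n} s E F {v} c sv≡free = begin
  ascents s E F
    ≡⟨ sum-cong-≗ (λ a → sum-cong-≗ (split a)) ⟩
  ∑[ a < n ] ∑[ b < n ] (T′ a b + (δ a v * O b + δ b v * I a))
    ≡⟨ ∑∑-+ T′ _ ⟩
  ascents s′ E F + ∑[ a < n ] ∑[ b < n ] (δ a v * O b + δ b v * I a)
    ≡⟨ cong (ascents s′ E F +_) (∑∑-+ (λ a b → δ a v * O b) _) ⟩
  ascents s′ E F + (∑[ a < n ] ∑[ b < n ] (δ a v * O b) + ∑[ a < n ] ∑[ b < n ] (δ b v * I a))
    ≡⟨ cong (ascents s′ E F +_) (cong₂ _+_ (∑δ-row v O) (∑δ-col v I)) ⟩
  ascents s′ E F + (∑ O + ∑ I) ∎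
  where
  s′ : Fin n → Vertex
  s′ = freeze s v c
  T′ : Fin n → Fin n → ℕ
  T′ a b = ⟦ isFree (s′ a) ∧ isFree (s′ b) ∧ E a b ∧ (F a <ᵇ F b) ⟧
  O I : Fin n → ℕ
  O b = ⟦ isFree (s′ b) ∧ E v b ∧ (F v <ᵇ F b) ⟧
  I a = ⟦ isFree (s′ a) ∧ E a v ∧ (F a <ᵇ F v) ⟧
  split : ∀ a b →
    ⟦ isFree (s a) ∧ isFree (s b) ∧ E a b ∧ (F a <ᵇ F b) ⟧ ≡ T′ a b + (δ a v * O b + δ b v * I a)
  split a b with a ≟ v | b ≟ v
  ... | yes refl | yes refl
    rewrite sv≡free | freeze-same s a c | n<ᵇn≡false (F a) | ∧-zeroʳ (E a a) = refl
  ... | yes refl | no b≢v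
    rewrite sv≡free | freeze-same s a c | freeze-other s c b≢v = sym (trans (+-identityʳ _) (+-identityʳ _))
  ... | no a≢v   | yes refl
    rewrite sv≡free | freeze-same s b c | freeze-other s c a≢v | ∧-zeroʳ (isFree (s a)) = sym (+-identityʳ _)
  ... | no a≢v   | no b≢v
    rewrite freeze-other s c a≢v | freeze-other s c b≢v = sym (+-identityʳ _)

weight-freeze : ∀ {n} (s : Fin n → Vertex) x₁ x₂ (F : Fin n → ℕ) v c →
  weight (freeze s v c) x₁ x₂ F * vertexWeight x₁ x₂ (s v) (F v) ≡ weight s x₁ x₂ F * ⟦ F v ≡ᵇ c ⟧
weight-freeze s x₁ x₂ F fzero c =
  solve 3 (λ A P B → A :* P :* B := B :* P :* A) refl
    ⟦ F fzero ≡ᵇ c ⟧ (weight (s ∘ fsuc) x₁ x₂ (F ∘ fsuc)) (vertexWeight x₁ x₂ (s fzero) (F fzero))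
weight-freeze s x₁ x₂ F (fsuc v) c = begin
  w₀ * weight (freeze (s ∘ fsuc) v c) x₁ x₂ (F ∘ fsuc) * vertexWeight x₁ x₂ (s (fsuc v)) (F (fsuc v))
    ≡⟨ *-assoc w₀ _ _ ⟩
  w₀ * (weight (freeze (s ∘ fsuc) v c) x₁ x₂ (F ∘ fsuc) * vertexWeight x₁ x₂ (s (fsuc v)) (F (fsuc v)))
    ≡⟨ cong (w₀ *_) (weight-freeze (s ∘ fsuc) x₁ x₂ (F ∘ fsuc) v c) ⟩
  w₀ * (weight (s ∘ fsuc) x₁ x₂ (F ∘ fsuc) * ⟦ F (fsuc v) ≡ᵇ c ⟧)
    ≡⟨ *-assoc w₀ _ _ ⟨
  w₀ * weight (s ∘ fsuc) x₁ x₂ (F ∘ fsuc) * ⟦ F (fsuc v) ≡ᵇ c ⟧ ∎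
  where
  w₀ : ℕ
  w₀ = vertexWeight x₁ x₂ (s fzero) (F fzero)

edges-freeze : ∀ {n} (s : Fin n → Vertex) (E : Digraph n) v c → edges (freeze s v c) E ≤ edges s E
edges-freeze s E v c = ∑-mono (λ a → ∑-mono (pointwise a))
  where
  pointwise : ∀ a b →
    ⟦ isFree (freeze s v c a) ∧ isFree (freeze s v c b) ∧ E a b ⟧ ≤ ⟦ isFree (s a) ∧ isFree (s b) ∧ E a b ⟧
  pointwise a b with freeze s v c a in ea | freeze s v c b in eb
  ... | free     | free     rewrite freeze-free⁻ s c ea | freeze-free⁻ s c eb = ≤-refl
  ... | free     | frozen _ = z≤n
  ... | frozen _ | _        = z≤n

EPositive-vertex : ∀ σ → EPositive (λ x₁ x₂ _ → vertexWeight x₁ x₂ σ 1 + vertexWeight x₁ x₂ σ 2)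
EPositive-vertex free       = EPositive-e₁
EPositive-vertex (frozen d) = EPositive-const (⟦ 1 ≡ᵇ d ⟧ + ⟦ 2 ≡ᵇ d ⟧)

Edgeless : ∀ {n} → (Fin n → Vertex) → Digraph n → Set
Edgeless s E = ∀ {a b} → s a ≡ free → s b ≡ free → E a b ≡ false

G-edgeless : ∀ {n} (s : Fin n → Vertex) (E : Digraph n) → Edgeless s E →
  EPositive (λ x₁ x₂ q → G s E x₁ x₂ (q + 1))
G-edgeless {n} s E edgeless = EPositive-resp expand (EPositive-∏ _ (λ v → EPositive-vertex (s v)))
  where
  no-ascents : ∀ F → ascents s E F ≡ 0
  no-ascents F = ∑-zero (λ a → ∑-zero (pointwise a))
    where
    pointwise : ∀ a b → ⟦ isFree (s a) ∧ isFree (s b) ∧ E a b ∧ (F a <ᵇ F b) ⟧ ≡ 0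
    pointwise a b with s a in sa | s b in sb
    ... | free     | free     rewrite edgeless sa sb = refl
    ... | free     | frozen _ = refl
    ... | frozen _ | _        = refl
  expand : ∀ x₁ x₂ q →
    G s E x₁ x₂ (q + 1) ≡ ∏ (λ v → vertexWeight x₁ x₂ (s v) 1 + vertexWeight x₁ x₂ (s v) 2)
  expand x₁ x₂ q = begin
    G s E x₁ x₂ (q + 1)
      ≡⟨ Σ₂-cong n (λ F _ → cong (λ e → weight s x₁ x₂ F * (q + 1) ^ e) (no-ascents F)) ⟩
    Σ₂ n (λ F → weight s x₁ x₂ F * 1)
      ≡⟨ Σ₂-cong n (λ F _ → *-identityʳ _) ⟩
    Σ₂ n (weight s x₁ x₂)
      ≡⟨ Σ₂-∏ n (λ v → vertexWeight x₁ x₂ (s v)) ⟩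
    ∏ (λ v → vertexWeight x₁ x₂ (s v) 1 + vertexWeight x₁ x₂ (s v) 2) ∎

-- Removing a twin edge

module TwinEdge {n} (s : Fin n → Vertex) (E : Digraph n) {i j : Fin n}
  (si≡free : s i ≡ free) (sj≡free : s j ≡ free) (i≢j : i ≢ j) (Eij : E i j ≡ true)
  (twin : ∀ {m} → s m ≡ free → m ≢ i → m ≢ j → E i m ≡ E m j) where

  E′ : Digraph n
  E′ = removeEdge E i j

  s₁ s₂ : Fin n → Vertex
  s₁ = freeze s i 1
  s₂ = freeze s₁ j 2

  k : ℕ
  k = ∑[ m < n ] ⟦ isFree (s₂ m) ∧ E i m ⟧

  s₁j≡free : s₁ j ≡ free
  s₁j≡free = trans (freeze-other s 1 (i≢j ∘ sym)) sj≡free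

  s₂i≡frozen : s₂ i ≡ frozen 1
  s₂i≡frozen = trans (freeze-other s₁ 2 i≢j) (freeze-same s i 1)

  s₂-other : ∀ {m} → m ≢ i → m ≢ j → s₂ m ≡ s m
  s₂-other m≢i m≢j = trans (freeze-other s₁ 2 m≢j) (freeze-other s 1 m≢i)

  count-removeEdge : (φ : Fin n → Fin n → Bool → Bool) → φ i j false ≡ false →
    count (λ a b → isFree (s a) ∧ isFree (s b) ∧ φ a b (E a b)) ≡
    count (λ a b → isFree (s a) ∧ isFree (s b) ∧ φ a b (E′ a b)) + ⟦ φ i j true ⟧
  count-removeEdge φ φij =
    trans (count-remove _ _ removed kept) (cong (λ e → count R′ + ⟦ e ⟧) present)
    where
    R′ : Digraph n
    R′ a b = isFree (s a) ∧ isFree (s b) ∧ φ a b (E′ a b)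
    present : (isFree (s i) ∧ isFree (s j) ∧ φ i j (E i j)) ≡ φ i j true
    present rewrite si≡free | sj≡free | Eij = refl
    removed : (isFree (s i) ∧ isFree (s j) ∧ φ i j (E′ i j)) ≡ false
    removed rewrite si≡free | sj≡free | removeEdge-removes E i j = φij
    kept : ∀ {a b} → a ≢ i ⊎ b ≢ j →
      (isFree (s a) ∧ isFree (s b) ∧ φ a b (E′ a b)) ≡ (isFree (s a) ∧ isFree (s b) ∧ φ a b (E a b))
    kept {a} {b} ne = cong (λ e → isFree (s a) ∧ isFree (s b) ∧ φ a b e) (removeEdge-keeps E ne)

  edges-removeEdge : edges s E ≡ suc (edges s E′)
  edges-removeEdge = trans (count-removeEdge (λ _ _ e → e) refl) (+-comm _ 1)

  ascents-removeEdge : ∀ F → ascents s E F ≡ ascents s E′ F + ⟦ F i <ᵇ F j ⟧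
  ascents-removeEdge F = count-removeEdge (λ a b e → e ∧ (F a <ᵇ F b)) refl

  module _ (F : Fin n → ℕ) (F₂ : IsTwoColoring F) (Fi≡1 : F i ≡ 1) (Fj≡2 : F j ≡ 2) where

    no-ascent-into-i : inAscents s₁ E′ F i ≡ 0
    no-ascent-into-i = ∑-zero vanish
      where
      vanish : ∀ a → ⟦ isFree (s₁ a) ∧ E′ a i ∧ (F a <ᵇ F i) ⟧ ≡ 0
      vanish a rewrite Fi≡1 | color≮1 (F₂ a) = cong ⟦_⟧ (∧-∧-false (isFree (s₁ a)) (E′ a i))

    no-ascent-out-of-j : outAscents s₂ E′ F j ≡ 0
    no-ascent-out-of-j = ∑-zero vanish
      where
      vanish : ∀ b → ⟦ isFree (s₂ b) ∧ E′ j b ∧ (F j <ᵇ F b) ⟧ ≡ 0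
      vanish b rewrite Fj≡2 | color≯2 (F₂ b) = cong ⟦_⟧ (∧-∧-false (isFree (s₂ b)) (E′ j b))

    -- A free neighbor m of i is also one of j, and an ascent from i or into j according to its color.
    common-neighbor : ∀ m → Dec (m ≡ i) → Dec (m ≡ j) →
      ⟦ isFree (s₁ m) ∧ E′ i m ∧ (F i <ᵇ F m) ⟧ + ⟦ isFree (s₂ m) ∧ E′ m j ∧ (F m <ᵇ F j) ⟧ ≡
      ⟦ isFree (s₂ m) ∧ E i m ⟧
    common-neighbor m (yes refl) _ rewrite freeze-same s m 1 | s₂i≡frozen = refl
    common-neighbor m (no _) (yes refl)
      rewrite s₁j≡free | removeEdge-removes E i m | freeze-same s₁ m 2 = refl
    common-neighbor m (no m≢i) (no m≢j)
      rewrite s₂-other m≢i m≢j | freeze-other s 1 m≢i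
            | removeEdge-keeps E {i} {j} {i} {m} (inj₂ m≢j) | removeEdge-keeps E {i} {j} {m} {j} (inj₁ m≢i)
            | Fi≡1 | Fj≡2
      with s m in sm
    ... | free     rewrite twin sm m≢i m≢j = split-by-color (E m j) (F₂ m)
    ... | frozen _ = refl

    ascents-at-i-and-j : outAscents s₁ E′ F i + inAscents s₂ E′ F j ≡ k
    ascents-at-i-and-j =
      trans (sym (∑-distrib-+ (λ m → ⟦ isFree (s₁ m) ∧ E′ i m ∧ (F i <ᵇ F m) ⟧) _))
            (sum-cong-≗ (λ m → common-neighbor m (m ≟ i) (m ≟ j)))

    ascents-freezeBoth : ascents s E′ F ≡ k + ascents s₂ E′ F
    ascents-freezeBoth = begin
      ascents s E′ F
        ≡⟨ ascents-freeze s E′ F 1 si≡free ⟩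
      ascents s₁ E′ F + (out₁ + in₁)
        ≡⟨ cong (_+ (out₁ + in₁)) (ascents-freeze s₁ E′ F 2 s₁j≡free) ⟩
      ascents s₂ E′ F + (out₂ + in₂) + (out₁ + in₁)
        ≡⟨ cong₂ (λ x y → ascents s₂ E′ F + (x + in₂) + (out₁ + y)) no-ascent-out-of-j no-ascent-into-i ⟩
      ascents s₂ E′ F + (0 + in₂) + (out₁ + 0)
        ≡⟨ solve 3 (λ A I O → A :+ (con 0 :+ I) :+ (O :+ con 0) := O :+ I :+ A) refl _ in₂ out₁ ⟩
      out₁ + in₂ + ascents s₂ E′ F
        ≡⟨ cong (_+ ascents s₂ E′ F) ascents-at-i-and-j ⟩
      k + ascents s₂ E′ F ∎
      where
      out₁ in₁ out₂ in₂ : ℕ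
      out₁ = outAscents s₁ E′ F i
      in₁  = inAscents s₁ E′ F i
      out₂ = outAscents s₂ E′ F j
      in₂  = inAscents s₂ E′ F j

    weight-freezeBoth : ∀ x₁ x₂ → weight s x₁ x₂ F ≡ e₂ x₁ x₂ * weight s₂ x₁ x₂ F
    weight-freezeBoth x₁ x₂ = begin
      weight s x₁ x₂ F
        ≡⟨ *-identityʳ _ ⟨
      weight s x₁ x₂ F * 1
        ≡⟨ freezing-i ⟨
      weight s₁ x₁ x₂ F * x₁
        ≡⟨ cong (_* x₁) (trans (sym (*-identityʳ (weight s₁ x₁ x₂ F))) (sym freezing-j)) ⟩
      weight s₂ x₁ x₂ F * x₂ * x₁
        ≡⟨ solve 3 (λ W A B → W :* B :* A := A :* B :* W) refl (weight s₂ x₁ x₂ F) x₁ x₂ ⟩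
      x₁ * x₂ * weight s₂ x₁ x₂ F ∎
      where
      freezing-i : weight s₁ x₁ x₂ F * x₁ ≡ weight s x₁ x₂ F * 1
      freezing-i with weight-freeze s x₁ x₂ F i 1
      ... | eq rewrite si≡free | Fi≡1 = eq
      freezing-j : weight s₂ x₁ x₂ F * x₂ ≡ weight s₁ x₁ x₂ F * 1
      freezing-j with weight-freeze s₁ x₁ x₂ F j 2
      ... | eq rewrite s₁j≡free | Fj≡2 = eq

  weight-s₂-vanishes : ∀ x₁ x₂ F → F i ≡ 2 ⊎ F j ≡ 1 → weight s₂ x₁ x₂ F ≡ 0
  weight-s₂-vanishes x₁ x₂ F (inj₁ Fi≡2) = ∏-zero _ i vanish
    where
    vanish : vertexWeight x₁ x₂ (s₂ i) (F i) ≡ 0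
    vanish rewrite s₂i≡frozen | Fi≡2 = refl
  weight-s₂-vanishes x₁ x₂ F (inj₂ Fj≡1) = ∏-zero _ j vanish
    where
    vanish : vertexWeight x₁ x₂ (s₂ j) (F j) ≡ 0
    vanish rewrite freeze-same s₁ j 2 | Fj≡1 = refl

  G-summand-no-ij-ascent : ∀ x₁ x₂ q F → (F i <ᵇ F j) ≡ false → weight s₂ x₁ x₂ F ≡ 0 →
    weight s x₁ x₂ F * (q + 1) ^ (ascents s E′ F + ⟦ F i <ᵇ F j ⟧) ≡
    weight s x₁ x₂ F * (q + 1) ^ ascents s E′ F +
    q * e₂ x₁ x₂ * (q + 1) ^ k * (weight s₂ x₁ x₂ F * (q + 1) ^ ascents s₂ E′ F)
  G-summand-no-ij-ascent x₁ x₂ q F Fi≮Fj w₂≡0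
    rewrite Fi≮Fj | w₂≡0 | +-identityʳ (ascents s E′ F) | *-zeroʳ (q * e₂ x₁ x₂ * (q + 1) ^ k) =
    sym (+-identityʳ _)

  G-summand-twin : ∀ x₁ x₂ q F → IsTwoColoring F →
    weight s x₁ x₂ F * (q + 1) ^ ascents s E F ≡
    weight s x₁ x₂ F * (q + 1) ^ ascents s E′ F +
    q * e₂ x₁ x₂ * (q + 1) ^ k * (weight s₂ x₁ x₂ F * (q + 1) ^ ascents s₂ E′ F)
  G-summand-twin x₁ x₂ q F F₂ rewrite ascents-removeEdge F with F₂ i | F₂ j
  ... | inj₁ Fi≡1 | inj₂ Fj≡2
    rewrite Fi≡1 | Fj≡2 | ascents-freezeBoth F F₂ Fi≡1 Fj≡2 | weight-freezeBoth F F₂ Fi≡1 Fj≡2 x₁ x₂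
          | ^-distribˡ-+-* (q + 1) (k + ascents s₂ E′ F) 1 | ^-distribˡ-+-* (q + 1) k (ascents s₂ E′ F) =
    solve 5 (λ P W Q K A → P :* W :* (K :* A :* ((Q :+ con 1) :* con 1)) :=
                           P :* W :* (K :* A) :+ Q :* P :* K :* (W :* A))
      refl (e₂ x₁ x₂) (weight s₂ x₁ x₂ F) q ((q + 1) ^ k) ((q + 1) ^ ascents s₂ E′ F)
  ... | inj₁ Fi≡1 | inj₁ Fj≡1 =
    G-summand-no-ij-ascent x₁ x₂ q F (cong₂ _<ᵇ_ Fi≡1 Fj≡1) (weight-s₂-vanishes x₁ x₂ F (inj₂ Fj≡1))
  ... | inj₂ Fi≡2 | Fj₂ = G-summand-no-ij-ascent x₁ x₂ q F
    (trans (cong (_<ᵇ F j) Fi≡2) (color≯2 Fj₂)) (weight-s₂-vanishes x₁ x₂ F (inj₁ Fi≡2))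

  G-twin : ∀ x₁ x₂ q → G s E x₁ x₂ (q + 1) ≡
    G s E′ x₁ x₂ (q + 1) + q * e₂ x₁ x₂ * (q + 1) ^ k * G s₂ E′ x₁ x₂ (q + 1)
  G-twin x₁ x₂ q = begin
    G s E x₁ x₂ (q + 1)
      ≡⟨ Σ₂-cong n (G-summand-twin x₁ x₂ q) ⟩
    Σ₂ n (λ F → term E′ s F + c * term E′ s₂ F)
      ≡⟨ Σ₂-+ n (term E′ s) _ ⟩
    G s E′ x₁ x₂ (q + 1) + Σ₂ n (λ F → c * term E′ s₂ F)
      ≡⟨ cong (G s E′ x₁ x₂ (q + 1) +_) (Σ₂-* n c (term E′ s₂)) ⟩
    G s E′ x₁ x₂ (q + 1) + c * G s₂ E′ x₁ x₂ (q + 1) ∎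
    where
    c : ℕ
    c = q * e₂ x₁ x₂ * (q + 1) ^ k
    term : Digraph n → (Fin n → Vertex) → (Fin n → ℕ) → ℕ
    term R σ F = weight σ x₁ x₂ F * (q + 1) ^ ascents σ R F

-- Arcs of the cycle

[m%d+n]%d≡[m+n]%d : ∀ m n d .{{_ : NonZero d}} → (m % d + n) % d ≡ (m + n) % d
[m%d+n]%d≡[m+n]%d m n d = begin
  (m % d + n) % d           ≡⟨ %-distribˡ-+ (m % d) n d ⟩
  (m % d % d + n % d) % d   ≡⟨ cong (λ x → (x + n % d) % d) (m%n%n≡m%n m d) ⟩
  (m % d + n % d) % d       ≡⟨ %-distribˡ-+ m n d ⟨
  (m + n) % d               ∎

module Circle {n : ℕ} .{{_ : NonZero n}} where

  toℕ-+ₙ : ∀ (i : Fin n) k → toℕ (i +ₙ k) ≡ (toℕ i + k) % n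
  toℕ-+ₙ i k = toℕ-fromℕ< (m%n<n (toℕ i + k) n)

  +ₙ-assoc : ∀ (i : Fin n) k l → (i +ₙ k) +ₙ l ≡ i +ₙ (k + l)
  +ₙ-assoc i k l = toℕ-injective (begin
    toℕ ((i +ₙ k) +ₙ l)        ≡⟨ toℕ-+ₙ (i +ₙ k) l ⟩
    (toℕ (i +ₙ k) + l) % n     ≡⟨ cong (λ x → (x + l) % n) (toℕ-+ₙ i k) ⟩
    ((toℕ i + k) % n + l) % n  ≡⟨ [m%d+n]%d≡[m+n]%d (toℕ i + k) l n ⟩
    (toℕ i + k + l) % n        ≡⟨ cong (_% n) (+-assoc (toℕ i) k l) ⟩
    (toℕ i + (k + l)) % n      ≡⟨ toℕ-+ₙ i (k + l) ⟨
    toℕ (i +ₙ (k + l))         ∎)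

  +ₙ-identityʳ : ∀ (i : Fin n) → i +ₙ 0 ≡ i
  +ₙ-identityʳ i = toℕ-injective (begin
    toℕ (i +ₙ 0)     ≡⟨ toℕ-+ₙ i 0 ⟩
    (toℕ i + 0) % n  ≡⟨ cong (_% n) (+-identityʳ (toℕ i)) ⟩
    toℕ i % n        ≡⟨ m<n⇒m%n≡m (toℕ<n i) ⟩
    toℕ i            ∎)

  +ₙ-period : ∀ (i : Fin n) k → i +ₙ (n + k) ≡ i +ₙ k
  +ₙ-period i k = toℕ-injective (begin
    toℕ (i +ₙ (n + k))     ≡⟨ toℕ-+ₙ i (n + k) ⟩
    (toℕ i + (n + k)) % n  ≡⟨ cong (_% n) (solve 3 (λ x n k → x :+ (n :+ k) := x :+ k :+ n) refl (toℕ i) n k) ⟩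
    (toℕ i + k + n) % n    ≡⟨ [m+n]%n≡m%n (toℕ i + k) n ⟩
    (toℕ i + k) % n        ≡⟨ toℕ-+ₙ i k ⟨
    toℕ (i +ₙ k)           ∎)

  dist : Fin n → Fin n → ℕ
  dist i m = (toℕ m + (n ∸ toℕ i)) % n

  dist<n : ∀ i m → dist i m < n
  dist<n i m = m%n<n (toℕ m + (n ∸ toℕ i)) n

  +ₙ-dist : ∀ i m → i +ₙ dist i m ≡ m
  +ₙ-dist i m = toℕ-injective (begin
    toℕ (i +ₙ dist i m)                      ≡⟨ toℕ-+ₙ i (dist i m) ⟩
    (toℕ i + (toℕ m + (n ∸ toℕ i)) % n) % n  ≡⟨ cong (_% n) (+-comm (toℕ i) _) ⟩
    ((toℕ m + (n ∸ toℕ i)) % n + toℕ i) % n  ≡⟨ [m%d+n]%d≡[m+n]%d (toℕ m + (n ∸ toℕ i)) (toℕ i) n ⟩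
    (toℕ m + (n ∸ toℕ i) + toℕ i) % n        ≡⟨ cong (_% n) (+-assoc (toℕ m) _ _) ⟩
    (toℕ m + ((n ∸ toℕ i) + toℕ i)) % n      ≡⟨ cong (λ x → (toℕ m + x) % n) (m∸n+n≡m i≤n) ⟩
    (toℕ m + n) % n                          ≡⟨ [m+n]%n≡m%n (toℕ m) n ⟩
    toℕ m % n                                ≡⟨ m<n⇒m%n≡m (toℕ<n m) ⟩
    toℕ m                                    ∎)
    where
    i≤n : toℕ i ≤ n
    i≤n = <⇒≤ (toℕ<n i)

  dist-unique : ∀ i m {d} → d < n → i +ₙ d ≡ m → dist i m ≡ d
  dist-unique i m {d} d<n refl = begin
    (toℕ (i +ₙ d) + (n ∸ toℕ i)) % n      ≡⟨ cong (λ x → (x + (n ∸ toℕ i)) % n) (toℕ-+ₙ i d) ⟩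
    ((toℕ i + d) % n + (n ∸ toℕ i)) % n   ≡⟨ [m%d+n]%d≡[m+n]%d (toℕ i + d) (n ∸ toℕ i) n ⟩
    (toℕ i + d + (n ∸ toℕ i)) % n         ≡⟨ cong (_% n) (x+d+y≡d+[x+y] (toℕ i) d (n ∸ toℕ i)) ⟩
    (d + (toℕ i + (n ∸ toℕ i))) % n       ≡⟨ cong (λ x → (d + x) % n) (m+[n∸m]≡n (<⇒≤ (toℕ<n i))) ⟩
    (d + n) % n                           ≡⟨ [m+n]%n≡m%n d n ⟩
    d % n                                 ≡⟨ m<n⇒m%n≡m d<n ⟩
    d                                     ∎
    where
    x+d+y≡d+[x+y] : ∀ x d y → x + d + y ≡ d + (x + y)
    x+d+y≡d+[x+y] = solve 3 (λ x d y → x :+ d :+ y := d :+ (x :+ y)) refl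

  dist-add : ∀ i m j → dist i m + dist m j ≡ dist i j ⊎ dist i m + dist m j ≡ n + dist i j
  dist-add i m j with dist i m + dist m j <? n
  ... | yes x<n = inj₁ (sym (dist-unique i j x<n reach))
    where
    reach : i +ₙ (dist i m + dist m j) ≡ j
    reach = trans (sym (+ₙ-assoc i _ _)) (trans (cong (_+ₙ dist m j) (+ₙ-dist i m)) (+ₙ-dist m j))
  ... | no x≮n = inj₂ (begin
    x                   ≡⟨ m+[n∸m]≡n n≤x ⟨
    n + (x ∸ n)         ≡⟨ cong (n +_) (dist-unique i j x∸n<n reach) ⟨
    n + dist i j        ∎)
    where
    x : ℕ
    x = dist i m + dist m j
    n≤x : n ≤ x
    n≤x = ≮⇒≥ x≮n
    x∸n<n : x ∸ n < n
    x∸n<n = +-cancelʳ-< n (x ∸ n) n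
      (subst (_< n + n) (sym (m∸n+n≡m n≤x)) (+-mono-< (dist<n i m) (dist<n m j)))
    reach : i +ₙ (x ∸ n) ≡ j
    reach = begin
      i +ₙ (x ∸ n)          ≡⟨ +ₙ-period i (x ∸ n) ⟨
      i +ₙ (n + (x ∸ n))    ≡⟨ cong (i +ₙ_) (m+[n∸m]≡n n≤x) ⟩
      i +ₙ x                ≡⟨ +ₙ-assoc i _ _ ⟨
      (i +ₙ dist i m) +ₙ dist m j ≡⟨ cong (_+ₙ dist m j) (+ₙ-dist i m) ⟩
      m +ₙ dist m j         ≡⟨ +ₙ-dist m j ⟩
      j                     ∎

  dist-self : ∀ i → dist i i ≡ 0
  dist-self i = dist-unique i i (>-nonZero⁻¹ n) (+ₙ-identityʳ i)

  dist-injective : ∀ i {m m′} → dist i m ≡ dist i m′ → m ≡ m′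
  dist-injective i {m} {m′} eq = trans (sym (+ₙ-dist i m)) (trans (cong (i +ₙ_) eq) (+ₙ-dist i m′))

  dist-split : ∀ a m p → dist a m < dist a p → dist a m + dist m p ≡ dist a p
  dist-split a m p am<ap with dist-add a m p
  ... | inj₁ eq = eq
  ... | inj₂ eq = ⊥-elim (<-irrefl (trans eq (+-comm n _)) (+-mono-< am<ap (dist<n m p)))

  dist-beyond : ∀ i m j → dist i j < dist i m → dist i j < dist m j
  dist-beyond i m j ij<im with dist-add i m j | dist i j <? dist m j
  ... | _       | yes ij<mj = ij<mj
  ... | inj₁ eq | no _      = ⊥-elim (<⇒≱ ij<im (subst (dist i m ≤_) eq (m≤m+n _ _)))
  ... | inj₂ eq | no ij≮mj  = ⊥-elim (<-irrefl eq (+-mono-<-≤ (dist<n i m) (≮⇒≥ ij≮mj)))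

  dist-pos : ∀ {i m} → m ≢ i → 0 < dist i m
  dist-pos {i} {m} m≢i = n≢0⇒n>0 (λ d≡0 → m≢i (dist-injective i (trans d≡0 (sym (dist-self i)))))

  record ArcClosed (s : Fin n → Vertex) (E : Digraph n) : Set where
    field
      loopless        : ∀ a → E a a ≡ false
      edge-to-inner   : ∀ {a m p} → s a ≡ free → s m ≡ free → s p ≡ free → E a p ≡ true →
                        0 < dist a m → dist a m < dist a p → E a m ≡ true
      edge-from-inner : ∀ {a m p} → s a ≡ free → s m ≡ free → s p ≡ free → E a p ≡ true →
                        0 < dist a m → dist a m < dist a p → E m p ≡ true

  record LongestEdge (s : Fin n → Vertex) (E : Digraph n) : Set where
    field
      i j     : Fin n
      si≡free : s i ≡ free
      sj≡free : s j ≡ free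
      Eij     : E i j ≡ true
      longest : ∀ {a b} → s a ≡ free → s b ≡ free → E a b ≡ true → dist a b ≤ dist i j

  module _ {s : Fin n → Vertex} {E : Digraph n} (closed : ArcClosed s E) (L : LongestEdge s E) where
    open ArcClosed closed
    open LongestEdge L

    longest-endpoints-differ : i ≢ j
    longest-endpoints-differ refl with () ← trans (sym Eij) (loopless i)

    -- A free m strictly inside the arc of i → j is joined from i and to j; one outside the arc
    -- is joined to neither, since i → m or m → j would be longer than i → j.
    longest-twin : ∀ {m} → s m ≡ free → m ≢ i → m ≢ j → E i m ≡ E m j
    longest-twin {m} sm m≢i m≢j = Bool.⇔→≡ (mk⇔ forward backward)
      where
      im≢ij : dist i m ≢ dist i j
      im≢ij = m≢j ∘ dist-injective i
      forward : E i m ≡ true → E m j ≡ true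
      forward Eim = edge-from-inner si≡free sm sj≡free Eij (dist-pos m≢i)
                 (≤∧≢⇒< (longest si≡free sm Eim) im≢ij)
      backward : E m j ≡ true → E i m ≡ true
      backward Emj with <-cmp (dist i m) (dist i j)
      ... | tri< im<ij _ _ = edge-to-inner si≡free sm sj≡free Eij (dist-pos m≢i) im<ij
      ... | tri≈ _ im≡ij _ = ⊥-elim (im≢ij im≡ij)
      ... | tri> _ _ ij<im = ⊥-elim (<⇒≱ (dist-beyond i m j ij<im) (longest sm sj≡free Emj))

    same-pair? : ∀ a b → (a ≡ i × b ≡ j) ⊎ (a ≢ i ⊎ b ≢ j)
    same-pair? a b with a ≟ i | b ≟ j
    ... | yes a≡i | yes b≡j = inj₁ (a≡i , b≡j)
    ... | no a≢i  | _       = inj₂ (inj₁ a≢i)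
    ... | yes _   | no b≢j  = inj₂ (inj₂ b≢j)

    removeEdge⊆ : ∀ {a b} → removeEdge E i j a b ≡ true → E a b ≡ true
    removeEdge⊆ {a} {b} eq with E a b
    ... | true = refl

    ArcClosed-removeLongest : ArcClosed s (removeEdge E i j)
    ArcClosed-removeLongest = record
      { loopless        = λ a → cong (_∧ _) (loopless a)
      ; edge-to-inner   = λ sa sm sp → to-inner sa sm sp ∘ removeEdge⊆
      ; edge-from-inner = λ sa sm sp → from-inner sa sm sp ∘ removeEdge⊆
      }
      where
      to-inner : ∀ {a m p} → s a ≡ free → s m ≡ free → s p ≡ free → E a p ≡ true →
                 0 < dist a m → dist a m < dist a p → removeEdge E i j a m ≡ true
      to-inner {a} {m} sa sm sp Eap am>0 am<ap with same-pair? a m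
      ... | inj₁ (refl , refl) = ⊥-elim (<⇒≱ am<ap (longest sa sp Eap))
      ... | inj₂ off           = trans (removeEdge-keeps E off) (edge-to-inner sa sm sp Eap am>0 am<ap)
      from-inner : ∀ {a m p} → s a ≡ free → s m ≡ free → s p ≡ free → E a p ≡ true →
                   0 < dist a m → dist a m < dist a p → removeEdge E i j m p ≡ true
      from-inner {a} {m} {p} sa sm sp Eap am>0 am<ap with same-pair? m p
      ... | inj₁ (refl , refl) = ⊥-elim (<⇒≱ beyond (longest sa sp Eap))
        where
        beyond : dist m p < dist a p
        beyond = subst (dist m p <_) (dist-split a m p am<ap) (m<n+m (dist m p) am>0)
      ... | inj₂ off           = trans (removeEdge-keeps E off) (edge-from-inner sa sm sp Eap am>0 am<ap)

  ArcClosed-freeze : ∀ {s : Fin n → Vertex} {E : Digraph n} v c → ArcClosed s E → ArcClosed (freeze s v c) E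
  ArcClosed-freeze {s} v c closed = record
    { loopless        = loopless
    ; edge-to-inner   = λ sa sm sp → edge-to-inner (free⁻ sa) (free⁻ sm) (free⁻ sp)
    ; edge-from-inner = λ sa sm sp → edge-from-inner (free⁻ sa) (free⁻ sm) (free⁻ sp)
    }
    where
    open ArcClosed closed
    free⁻ : ∀ {u} → freeze s v c u ≡ free → s u ≡ free
    free⁻ = freeze-free⁻ s c

  isFreeEdge : (Fin n → Vertex) → Digraph n → Fin n × Fin n → Bool
  isFreeEdge s E (a , b) = isFree (s a) ∧ isFree (s b) ∧ E a b

  free-edge : ∀ {s : Fin n → Vertex} {E a b} → isFreeEdge s E (a , b) ≡ true →
              s a ≡ free × s b ≡ free × E a b ≡ true
  free-edge {s} {E} {a} {b} eq with s a | s b | E a b | eq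
  ... | free | free | true | _ = refl , refl , refl

  to-free-edge : ∀ {s : Fin n → Vertex} {E a b} → s a ≡ free → s b ≡ free → E a b ≡ true →
                 isFreeEdge s E (a , b) ≡ true
  to-free-edge sa sb Eab rewrite sa | sb | Eab = refl

  longest-or-edgeless : ∀ s E → Edgeless s E ⊎ LongestEdge s E
  longest-or-edgeless s E = search (filter P? pairs) (all-filter P? pairs) (∈-filter⁺ P?)
    where
    pairs : List (Fin n × Fin n)
    pairs = cartesianProduct (allFin n) (allFin n)
    ∈-pairs : ∀ a b → (a , b) ∈ pairs
    ∈-pairs a b = ∈-cartesianProduct⁺ (∈-allFin a) (∈-allFin b)
    P : Fin n × Fin n → Set
    P e = isFreeEdge s E e ≡ true
    P? : Decidable P
    P? e = isFreeEdge s E e Bool.≟ true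
    search : ∀ es → All P es → (∀ {e} → e ∈ pairs → P e → e ∈ es) →
             Edgeless s E ⊎ LongestEdge s E
    search [] _ complete = inj₁ edgeless
      where
      edgeless : Edgeless s E
      edgeless {a} {b} sa sb with E a b in Eab
      ... | false = refl
      ... | true with () ← complete (∈-pairs a b) (to-free-edge {s} {E} sa sb Eab)
    search (e ∷ es) (Pe ∷ Pes) complete = inj₂ (record
      { i = proj₁ best ; j = proj₂ best
      ; si≡free = proj₁ best-free ; sj≡free = proj₁ (proj₂ best-free) ; Eij = proj₂ (proj₂ best-free)
      ; longest = longest })
      where
      best : Fin n × Fin n
      best = argmax (uncurry dist) e es
      best-free : s (proj₁ best) ≡ free × s (proj₂ best) ≡ free × E (proj₁ best) (proj₂ best) ≡ true
      best-free = free-edge {s} {E} (argmax-all (uncurry dist) Pe Pes)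
      longest : ∀ {a b} → s a ≡ free → s b ≡ free → E a b ≡ true → dist a b ≤ uncurry dist best
      longest {a} {b} sa sb Eab with complete (∈-pairs a b) (to-free-edge {s} {E} sa sb Eab)
      ... | here refl = f[⊥]≤f[argmax] {f = uncurry dist} e es
      ... | there ab∈ = All.lookup (f[xs]≤f[argmax] e es) ab∈

  G-EPositive : ∀ N (s : Fin n → Vertex) (E : Digraph n) → ArcClosed s E → edges s E < N →
    EPositive (λ x₁ x₂ q → G s E x₁ x₂ (q + 1))
  G-EPositive (suc N) s E closed (s≤s bound) with longest-or-edgeless s E
  ... | inj₁ edgeless = G-edgeless s E edgeless
  ... | inj₂ L = EPositive-resp G-twin (EPositive-+
    (G-EPositive N s E′ closed′ bound′)
    (EPositive-* coefficient (G-EPositive N s₂ E′ closed₂ bound₂)))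
    where
    open LongestEdge L
    open TwinEdge s E si≡free sj≡free (longest-endpoints-differ closed L) Eij (longest-twin closed L)
    closed′ : ArcClosed s E′
    closed′ = ArcClosed-removeLongest closed L
    closed₂ : ArcClosed s₂ E′
    closed₂ = ArcClosed-freeze j 2 (ArcClosed-freeze i 1 closed′)
    bound′ : edges s E′ < N
    bound′ = subst (_≤ N) edges-removeEdge bound
    bound₂ : edges s₂ E′ < N
    bound₂ = ≤-<-trans (≤-trans (edges-freeze s₁ E′ j 2) (edges-freeze s E′ i 1)) bound′
    coefficient : EPositive (λ x₁ x₂ q → q * e₂ x₁ x₂ * (q + 1) ^ k)
    coefficient = EPositive-* (EPositive-* EPositive-q EPositive-e₂)
                              (EPositive-^ k (EPositive-+ EPositive-q (EPositive-const 1)))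

open Circle

-- Circular area sequences

module CircularAreaSequence {n : ℕ} .{{_ : NonZero n}} (a : Fin n → ℕ) (area : IsCircularAreaSequence n a)
  where
  open IsCircularAreaSequence area

  window : ℕ → Fin n → Fin n → Bool
  window A i b = (0 <ᵇ dist i b) ∧ (dist i b ≤ᵇ A)

  arcEdges : Digraph n
  arcEdges i = window (a i) i

  a<n : ∀ i → a i < n
  a<n i = m≤pred[n]⇒suc[m]≤n (bounded i)

  dist≡ᵇ : ∀ i b {m} → m < n → ⟦ dist i b ≡ᵇ m ⟧ ≡ δ b (i +ₙ m)
  dist≡ᵇ i b {m} m<n with b ≟ i +ₙ m
  ... | yes refl rewrite dist-unique i (i +ₙ m) m<n refl = cong ⟦_⟧ (Bool.T-≡ .to (≡⇒≡ᵇ m m refl))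
  ... | no b≢i+m with dist i b ≡ᵇ m in eq
  ...   | false = refl
  ...   | true  = ⊥-elim (b≢i+m (begin
    b                 ≡⟨ +ₙ-dist i b ⟨
    i +ₙ dist i b     ≡⟨ cong (i +ₙ_) (≡ᵇ⇒≡ _ _ (Bool.T-≡ .from eq)) ⟩
    i +ₙ m            ∎))

  sum-window : ∀ i (g : Fin n → ℕ) A → A < n →
    sum (map (λ k → g (i +ₙ suc k)) (upTo A)) ≡ ∑[ b < n ] (⟦ window A i b ⟧ * g b)
  sum-window i g zero    _   = sym (∑-zero empty)
    where
    empty : ∀ b → ⟦ window 0 i b ⟧ * g b ≡ 0
    empty b with dist i b
    ... | zero  = refl
    ... | suc _ = refl
  sum-window i g (suc A) A<n = begin
    sum (map h (upTo (suc A)))                        ≡⟨ cong (sum ∘ map h) (upTo-∷ʳ A) ⟨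
    sum (map h (upTo A ∷ʳ A))                         ≡⟨ cong sum (map-++ h (upTo A) _) ⟩
    sum (map h (upTo A) ++ h A ∷ [])                  ≡⟨ sum-++ (map h (upTo A)) _ ⟩
    sum (map h (upTo A)) + (h A + 0)
      ≡⟨ cong₂ _+_ (sum-window i g A (<-trans (n<1+n A) A<n)) (+-identityʳ (h A)) ⟩
    ∑[ b < n ] (⟦ window A i b ⟧ * g b) + g (i +ₙ suc A)
      ≡⟨ cong (∑[ b < n ] (⟦ window A i b ⟧ * g b) +_) (∑-δ (i +ₙ suc A) g) ⟨
    ∑[ b < n ] (⟦ window A i b ⟧ * g b) + ∑[ b < n ] (δ b (i +ₙ suc A) * g b)
      ≡⟨ ∑-distrib-+ (λ b → ⟦ window A i b ⟧ * g b) _ ⟨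
    ∑[ b < n ] (⟦ window A i b ⟧ * g b + δ b (i +ₙ suc A) * g b)
      ≡⟨ sum-cong-≗ grow ⟩
    ∑[ b < n ] (⟦ window (suc A) i b ⟧ * g b)          ∎
    where
    h : ℕ → ℕ
    h k = g (i +ₙ suc k)
    grow : ∀ b → ⟦ window A i b ⟧ * g b + δ b (i +ₙ suc A) * g b ≡ ⟦ window (suc A) i b ⟧ * g b
    grow b = begin
      ⟦ window A i b ⟧ * g b + δ b (i +ₙ suc A) * g b
        ≡⟨ *-distribʳ-+ (g b) ⟦ window A i b ⟧ (δ b (i +ₙ suc A)) ⟨
      (⟦ window A i b ⟧ + δ b (i +ₙ suc A)) * g b
        ≡⟨ cong (λ x → (⟦ window A i b ⟧ + x) * g b) (dist≡ᵇ i b A<n) ⟨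
      (⟦ window A i b ⟧ + ⟦ dist i b ≡ᵇ suc A ⟧) * g b
        ≡⟨ cong (_* g b) (window-suc (dist i b)) ⟨
      ⟦ window (suc A) i b ⟧ * g b ∎
      where
      window-suc : ∀ d → ⟦ (0 <ᵇ d) ∧ (d ≤ᵇ suc A) ⟧ ≡ ⟦ (0 <ᵇ d) ∧ (d ≤ᵇ A) ⟧ + ⟦ d ≡ᵇ suc A ⟧
      window-suc zero    = refl
      window-suc (suc d) = ⟦<ᵇ-suc⟧ d A

  asc≡ascents : ∀ F → asc a F ≡ ascents (λ _ → free) arcEdges F
  asc≡ascents F =
    trans (sum-allFin (λ i → sum (map (λ k → ⟦ F i <ᵇ F (i +ₙ suc k) ⟧) (upTo (a i))))) (sum-cong-≗ λ i →
    trans (sum-window i (λ b → ⟦ F i <ᵇ F b ⟧) (a i) (a<n i)) (sum-cong-≗ λ b →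
    sym (⟦∧⟧ (arcEdges i b) _)))

  G₂≡G : ∀ x₁ x₂ t → G₂ a x₁ x₂ t ≡ G (λ _ → free) arcEdges x₁ x₂ t
  G₂≡G x₁ x₂ t = cong sum (map-cong summand (twoColorings n))
    where
    summand : ∀ F → monomial x₁ x₂ F * t ^ asc a F ≡
                    weight (λ _ → free) x₁ x₂ F * t ^ ascents (λ _ → free) arcEdges F
    summand F = cong₂ (λ w e → w * t ^ e) (product-allFin (λ v → xvar x₁ x₂ (F v))) (asc≡ascents F)

  a≤k+a[i+k] : ∀ i k → a i ≤ k + a (i +ₙ k)
  a≤k+a[i+k] i zero    = ≤-reflexive (cong a (sym (+ₙ-identityʳ i)))
  a≤k+a[i+k] i (suc k) =
    ≤-trans (a≤k+a[i+k] i k) (subst (k + a (i +ₙ k) ≤_) shift (+-monoʳ-≤ k (circ (i +ₙ k))))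
    where
    shift : k + suc (a ((i +ₙ k) +ₙ 1)) ≡ suc k + a (i +ₙ suc k)
    shift = trans (+-suc k _) (cong (λ v → suc k + a v) (trans (+ₙ-assoc i k 1) (cong (i +ₙ_) (+-comm k 1))))

  a≤dist+a : ∀ i m → a i ≤ dist i m + a m
  a≤dist+a i m = subst (λ v → a i ≤ dist i m + a v) (+ₙ-dist i m) (a≤k+a[i+k] i (dist i m))

  arcEdge⇒ : ∀ {i b} → arcEdges i b ≡ true → 0 < dist i b × dist i b ≤ a i
  arcEdge⇒ {i} {b} eq with 0 <ᵇ dist i b in p | dist i b ≤ᵇ a i in q
  ... | true | true = <ᵇ⇒< 0 _ (Bool.T-≡ .from p) , ≤ᵇ⇒≤ _ _ (Bool.T-≡ .from q)

  ⇒arcEdge : ∀ {i b} → 0 < dist i b → dist i b ≤ a i → arcEdges i b ≡ true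
  ⇒arcEdge ib>0 ib≤ai = cong₂ _∧_ (Bool.T-≡ .to (<⇒<ᵇ ib>0)) (Bool.T-≡ .to (≤⇒≤ᵇ ib≤ai))

  arcEdges-closed : ArcClosed (λ _ → free) arcEdges
  arcEdges-closed = record
    { loopless        = λ i → cong (λ d → (0 <ᵇ d) ∧ (d ≤ᵇ a i)) (dist-self i)
    ; edge-to-inner   = λ _ _ _ Eip im>0 im<ip → ⇒arcEdge im>0 (≤-trans (<⇒≤ im<ip) (proj₂ (arcEdge⇒ Eip)))
    ; edge-from-inner = from-inner
    }
    where
    from-inner : ∀ {i m p} → free ≡ free → free ≡ free → free ≡ free → arcEdges i p ≡ true →
                 0 < dist i m → dist i m < dist i p → arcEdges m p ≡ true
    from-inner {i} {m} {p} _ _ _ Eip im>0 im<ip = ⇒arcEdge mp>0 mp≤am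
      where
      split : dist i m + dist m p ≡ dist i p
      split = dist-split i m p im<ip
      mp>0 : 0 < dist m p
      mp>0 = +-cancelˡ-< (dist i m) 0 _ (subst₂ _<_ (sym (+-identityʳ _)) (sym split) im<ip)
      mp≤am : dist m p ≤ a m
      mp≤am = +-cancelˡ-≤ (dist i m) _ _
        (≤-trans (≤-reflexive split) (≤-trans (proj₂ (arcEdge⇒ Eip)) (a≤dist+a i m)))

mainTheorem7 : (n : ℕ) .{{_ : NonZero n}} (a : Fin n → ℕ) →
    IsCircularAreaSequence n a →
    Σ (List (ℕ × ℕ × List ℕ)) (λ terms →
      ∀ (x₁ x₂ q : ℕ) → G₂ a x₁ x₂ (q + 1) ≡ linComb terms x₁ x₂ q)
mainTheorem7 n a area = EPositive⇒linComb (EPositive-resp (λ x₁ x₂ q → G₂≡G x₁ x₂ (q + 1))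
  (G-EPositive _ (λ _ → free) arcEdges arcEdges-closed ≤-refl))
  where open CircularAreaSequence a area
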